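{- $R(K_3,K_3,C_4,C_4) \geq 27$. Equivalently, there exists a coloring of the edges of the complete graph $K_{26}$ with four colors $1,2,3,4$ such that there is no triangle all of whose edges have color $1$, no triangle all of whose edges have color $2$, no cycle of length four all of whose edges have color $3$, and no cycle of length four all of whose edges have color $4$.
   Context: For graphs $G_1,\dots,G_k$, the multicolor Ramsey number $R(G_1,\dots,G_k)$ is the least positive integer $n$ such that every coloring of the edges of $K_n$ with colors $1,\dots,k$ contains, for some $i$, a subgraph isomorphic to $G_i$ all of whose edges have color $i$. Here $K_3$ is the triangle and $C_4$ is the cycle of length four. -}

module Defs where

open import Data.Nat using (ℕ; _≤_; _<_)
open import Data.Fin using (Fin; zero; suc; toℕ)
open import Data.Product using (Σ; ∃; _×_; _,_)
open import Data.Empty using (⊥)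
open import Data.Unit using (⊤)
open import Relation.Nullary using (¬_)
open import Relation.Binary.PropositionalEquality using (_≡_; _≢_)
open import Function.Definitions using (Injective)
open import Data.Vec using (Vec; lookup)

record Graph : Set₁ where
  field
    V     : ℕ
    Adj   : Fin V → Fin V → Set
    sym   : ∀ {x y} → Adj x y → Adj y x
    irrefl : ∀ {x} → ¬ Adj x x
open Graph public

-- An edge colouring of K_n with k colours: a colour for every pair of
-- distinct vertices, symmetric. (Values on the diagonal are irrelevant.)
record EdgeColouring (n k : ℕ) : Set where
  field
    col     : Fin n → Fin n → Fin k
    col-sym : ∀ x y → col x y ≡ col y x
open EdgeColouring public

MonoCopy : ∀ {n k} → EdgeColouring n k → Graph → Fin k → Set
MonoCopy {n} c G i =
  Σ (Fin (V G) → Fin n) λ f →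
    Injective _≡_ _≡_ f × (∀ x y → Adj G x y → col c (f x) (f y) ≡ i)

RamseyArrows : ∀ {k} → ℕ → Vec Graph k → Set
RamseyArrows {k} n Gs = (c : EdgeColouring n k) → ∃ λ (i : Fin k) → MonoCopy c (lookup Gs i) i

-- R(G_1,…,G_k) ≥ m : no positive integer n < m has the Ramsey property
-- (R is the least positive n with the property).
RamseyGE : ∀ {k} → Vec Graph k → ℕ → Set
RamseyGE Gs m = ∀ n → 1 ≤ n → n < m → ¬ RamseyArrows n Gs

triAdj : Fin 3 → Fin 3 → Set
triAdj x y = x ≢ y

triangle : Graph
triangle = record { V = 3 ; Adj = triAdj ; sym = λ p q → p (Relation.Binary.PropositionalEquality.sym q) ; irrefl = λ p → p Relation.Binary.PropositionalEquality.refl }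

-- C_4 with vertices 0-1-2-3-0: adjacent iff indices differ by an odd amount.
c4Adj : Fin 4 → Fin 4 → Set
c4Adj zero zero = ⊥
c4Adj zero (suc zero) = ⊤
c4Adj zero (suc (suc zero)) = ⊥
c4Adj zero (suc (suc (suc zero))) = ⊤
c4Adj (suc zero) zero = ⊤
c4Adj (suc zero) (suc zero) = ⊥
c4Adj (suc zero) (suc (suc zero)) = ⊤
c4Adj (suc zero) (suc (suc (suc zero))) = ⊥
c4Adj (suc (suc zero)) zero = ⊥
c4Adj (suc (suc zero)) (suc zero) = ⊤
c4Adj (suc (suc zero)) (suc (suc zero)) = ⊥
c4Adj (suc (suc zero)) (suc (suc (suc zero))) = ⊤
c4Adj (suc (suc (suc zero))) zero = ⊤
c4Adj (suc (suc (suc zero))) (suc zero) = ⊥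
c4Adj (suc (suc (suc zero))) (suc (suc zero)) = ⊤
c4Adj (suc (suc (suc zero))) (suc (suc (suc zero))) = ⊥

c4Sym : ∀ {x y} → c4Adj x y → c4Adj y x
c4Sym {zero} {suc zero} _ = _
c4Sym {zero} {suc (suc (suc zero))} _ = _
c4Sym {suc zero} {zero} _ = _
c4Sym {suc zero} {suc (suc zero)} _ = _
c4Sym {suc (suc zero)} {suc zero} _ = _
c4Sym {suc (suc zero)} {suc (suc (suc zero))} _ = _
c4Sym {suc (suc (suc zero))} {zero} _ = _
c4Sym {suc (suc (suc zero))} {suc (suc zero)} _ = _
c4Sym {suc zero} {suc (suc (suc zero))} ()
c4Sym {suc (suc (suc zero))} {suc (suc (suc zero))} ()

c4Irr : ∀ {x} → ¬ c4Adj x x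
c4Irr {zero} ()
c4Irr {suc zero} ()
c4Irr {suc (suc zero)} ()
c4Irr {suc (suc (suc zero))} ()

cycle4 : Graph
cycle4 = record { V = 4 ; Adj = c4Adj ; sym = c4Sym ; irrefl = c4Irr }

module Submission where

-- The witness is a two-block circulant colouring: the vertices form two copies of ℤ₁₃, and the
-- colour of an edge depends only on the blocks of its ends and the difference of their residues.
-- Its colour classes are checked exhaustively, the C₄ classes in the form "two distinct vertices
-- have at most one common neighbour"; restricting it gives the colourings of the smaller K_n.

open import Defs
open import Data.Fin using (Fin; zero; suc; #_; inject≤; remQuot; toℕ; _≟_)
open import Data.Fin.Properties using (all?; inject≤-injective)
open import Data.Nat using (ℕ; suc; _+_; _∸_; _≤_; s≤s⁻¹)
open import Data.Nat.DivMod using (_mod_)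
open import Data.Product using (_×_; _,_; proj₁)
open import Data.Unit using (tt)
open import Function.Base using (_∘_)
open import Data.Vec using (Vec; []; _∷_; lookup)
open import Relation.Binary.PropositionalEquality using (_≡_; _≢_; subst)
open import Relation.Nullary using (¬_; Dec; ¬?; _×-dec_; _→-dec_)
open import Relation.Nullary.Decidable using (from-yes)

module _ {n k : ℕ} (χ : Fin n → Fin n → Fin k) (i : Fin k) where

  Edge : Fin n → Fin n → Set
  Edge x y = x ≢ y × χ x y ≡ i

  -- Hypotheses are interleaved with the quantifiers so that the decision procedures below
  -- prune the search as soon as a pair fails to be an edge.
  TriangleFree : Set
  TriangleFree = ∀ a b → Edge a b → ∀ c → Edge b c → ¬ Edge a c

  UniqueCommonNeighbours : Set
  UniqueCommonNeighbours =
    ∀ a c → a ≢ c → ∀ b → Edge a b → Edge c b → ∀ d → Edge a d → Edge c d → b ≡ d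

  edge? : ∀ x y → Dec (Edge x y)
  edge? x y = ¬? (x ≟ y) ×-dec χ x y ≟ i

  triangleFree? : Dec TriangleFree
  triangleFree? = all? λ a → all? λ b → edge? a b →-dec all? λ c → edge? b c →-dec ¬? (edge? a c)

  uniqueCommonNeighbours? : Dec UniqueCommonNeighbours
  uniqueCommonNeighbours? =
    all? λ a → all? λ c → ¬? (a ≟ c) →-dec
      all? λ b → edge? a b →-dec edge? c b →-dec all? λ d → edge? a d →-dec edge? c d →-dec b ≟ d

module _ {n k : ℕ} (c : EdgeColouring n k) {i : Fin k} where

  copy-edge : (G : Graph) (copy : MonoCopy c G i) →
              ∀ x y → Adj G x y → Edge (col c) i (proj₁ copy x) (proj₁ copy y)
  copy-edge G (f , f-inj , f-mono) x y x~y =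
    (λ fx≡fy → irrefl G (subst (λ z → Adj G z y) (f-inj fx≡fy) x~y)) , f-mono x y x~y

  triangleFree⇒¬copy : TriangleFree (col c) i → ¬ MonoCopy c triangle i
  triangleFree⇒¬copy free copy@(f , _) =
    free _ _ (edge (# 0) (# 1) λ ()) _ (edge (# 1) (# 2) λ ()) (edge (# 0) (# 2) λ ())
    where
    edge : ∀ x y → triAdj x y → Edge (col c) i (f x) (f y)
    edge = copy-edge triangle copy

  uniqueCommonNeighbours⇒¬c4copy : UniqueCommonNeighbours (col c) i → ¬ MonoCopy c cycle4 i
  uniqueCommonNeighbours⇒¬c4copy unique copy@(f , f-inj , _) = distinct (λ ()) f₁≡f₃
    where
    edge : ∀ x y → c4Adj x y → Edge (col c) i (f x) (f y)
    edge = copy-edge cycle4 copy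

    distinct : ∀ {x y} → x ≢ y → f x ≢ f y
    distinct x≢y = x≢y ∘ f-inj

    f₁≡f₃ : f (# 1) ≡ f (# 3)
    f₁≡f₃ = unique (f (# 0)) (f (# 2)) (distinct λ ())
              (f (# 1)) (edge (# 0) (# 1) tt) (edge (# 2) (# 1) tt)
              (f (# 3)) (edge (# 0) (# 3) tt) (edge (# 2) (# 3) tt)

restrict : ∀ {m n k} → n ≤ m → EdgeColouring m k → EdgeColouring n k
restrict n≤m c = record
  { col     = λ x y → col c (inject≤ x n≤m) (inject≤ y n≤m)
  ; col-sym = λ x y → col-sym c (inject≤ x n≤m) (inject≤ y n≤m)
  }

arrows-mono : ∀ {m n k} {Gs : Vec Graph k} → n ≤ m → RamseyArrows n Gs → RamseyArrows m Gs
arrows-mono n≤m arrows c with arrows (restrict n≤m c)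
... | i , f , f-inj , f-mono =
  i , (λ x → inject≤ (f x) n≤m) , (λ eq → f-inj (inject≤-injective n≤m n≤m _ _ eq)) , f-mono

¬arrows⇒ramseyGE : ∀ {m k} {Gs : Vec Graph k} → ¬ RamseyArrows m Gs → RamseyGE Gs (suc m)
¬arrows⇒ramseyGE {Gs = Gs} ¬arrows n _ n<1+m = ¬arrows ∘ arrows-mono {Gs = Gs} (s≤s⁻¹ n<1+m)

circulant : ∀ {k} → Vec (Fin k) 13 → Fin 13 → Fin 13 → Fin k
circulant d x y = lookup d ((toℕ y + 13 ∸ toℕ x) mod 13)

d₀₀ d₁₁ d₀₁ : Vec (Fin 4) 13
d₀₀ = # 0 ∷ # 1 ∷ # 0 ∷ # 2 ∷ # 3 ∷ # 1 ∷ # 0 ∷ # 0 ∷ # 1 ∷ # 3 ∷ # 2 ∷ # 0 ∷ # 1 ∷ []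
d₁₁ = # 0 ∷ # 1 ∷ # 0 ∷ # 3 ∷ # 2 ∷ # 1 ∷ # 0 ∷ # 0 ∷ # 1 ∷ # 2 ∷ # 3 ∷ # 0 ∷ # 1 ∷ []
d₀₁ = # 0 ∷ # 0 ∷ # 2 ∷ # 3 ∷ # 0 ∷ # 0 ∷ # 1 ∷ # 3 ∷ # 1 ∷ # 0 ∷ # 1 ∷ # 2 ∷ # 1 ∷ []

blockCirculant : Fin 2 × Fin 13 → Fin 2 × Fin 13 → Fin 4
blockCirculant (zero , x)     (zero , y)     = circulant d₀₀ x y
blockCirculant (suc zero , x) (suc zero , y) = circulant d₁₁ x y
blockCirculant (zero , x)     (suc zero , y) = circulant d₀₁ x y
blockCirculant (suc zero , x) (zero , y)     = circulant d₀₁ y x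

colouring : EdgeColouring 26 4
colouring = record
  { col     = colour
  ; col-sym = from-yes (all? λ x → all? λ y → colour x y ≟ colour y x)
  }
  where
  colour : Fin 26 → Fin 26 → Fin 4
  colour x y = blockCirculant (remQuot 13 x) (remQuot 13 y)

mainTheorem1 : RamseyGE (triangle ∷ triangle ∷ cycle4 ∷ cycle4 ∷ []) 27
mainTheorem1 = ¬arrows⇒ramseyGE {Gs = Gs} ¬arrows
  where
  Gs : Vec Graph 4
  Gs = triangle ∷ triangle ∷ cycle4 ∷ cycle4 ∷ []

  χ : Fin 26 → Fin 26 → Fin 4
  χ = col colouring

  ¬arrows : ¬ RamseyArrows 26 Gs
  ¬arrows arrows with arrows colouring
  ... | zero , copy =
    triangleFree⇒¬copy colouring (from-yes (triangleFree? χ (# 0))) copy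
  ... | suc zero , copy =
    triangleFree⇒¬copy colouring (from-yes (triangleFree? χ (# 1))) copy
  ... | suc (suc zero) , copy =
    uniqueCommonNeighbours⇒¬c4copy colouring (from-yes (uniqueCommonNeighbours? χ (# 2))) copy
  ... | suc (suc (suc zero)) , copy =
    uniqueCommonNeighbours⇒¬c4copy colouring (from-yes (uniqueCommonNeighbours? χ (# 3))) copy
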